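{- Let $(X,\preccurlyeq,s)$ be a Maximum Common Subelement (MCS) Model. Then for all $x_1,x_2,x_3\in X$, $$s'(\{x_1,x_2\})+s'(\{x_2,x_3\})\le s(x_2)+s'(\{x_1,x_3\}).$$
   Context: For a partial order $\preccurlyeq$ on a set $X$ and $X'\subseteq X$, $cs(X')=\{x\in X: x\preccurlyeq y \text{ for all } y\in X'\}$. A size function on $(X,\preccurlyeq)$ is $s:X\to[0,\infty)$ with (S1) $x_1\preccurlyeq x_2\Rightarrow s(x_1)\le s(x_2)$ and (S2) $x_1\preccurlyeq x_2$ and $s(x_1)=s(x_2)$ $\Rightarrow x_1=x_2$. An MCS Model is a triple $(X,\preccurlyeq,s)$ with $\preccurlyeq$ a partial order on $X$, $s$ a size function, and (A1) for all $x_1,x_2\in X$, $cs(\{x_1,x_2\})\ne\emptyset$ and $\{s(x)\mid x\in cs(\{x_1,x_2\})\}$ has a maximum; (A2) for all $x_1,x_2,x\in X$ with $x_1,x_2\preccurlyeq x$ there is $x_{12}\in cs(\{x_1,x_2\})$ with $s(x)\ge s(x_1)+s(x_2)-s(x_{12})$. For $x_1,x_2\in X$, $s'(\{x_1,x_2\})=\max\{s(x): x\in cs(\{x_1,x_2\})\}$. -}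

module Defs where

open import Level using (Level; _⊔_; suc)
open import Data.Product using (Σ; _×_; _,_; proj₁)
open import Relation.Binary.Core using (Rel)
open import Relation.Binary.PropositionalEquality using (_≡_)
open import Relation.Binary.Structures using (IsPartialOrder)
open import Algebra.Core using (Op₁; Op₂)
open import Algebra.Structures using (IsAbelianGroup)

-- The codomain of size functions.  The paper uses the real numbers, which
-- agda-stdlib lacks; we work over an arbitrary partially ordered abelian
-- group (ℝ with +, 0, -, ≤ is an instance).
record OrderedAbelianGroup (c ℓ₁ ℓ₂ : Level) : Set (suc (c ⊔ ℓ₁ ⊔ ℓ₂)) where
  infix  4 _≈_ _≤_
  infixl 6 _+_ _-_
  field
    Carrier         : Set c
    _≈_             : Rel Carrier ℓ₁
    _≤_             : Rel Carrier ℓ₂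
    _+_             : Op₂ Carrier
    0#              : Carrier
    -_              : Op₁ Carrier
    isAbelianGroup  : IsAbelianGroup _≈_ _+_ 0# -_
    isPartialOrder  : IsPartialOrder _≈_ _≤_
    +-monoˡ-≤       : ∀ {x y} z → x ≤ y → x + z ≤ y + z

  _-_ : Op₂ Carrier
  x - y = x + (- y)

module _ {c ℓ₁ ℓ₂ : Level} (R : OrderedAbelianGroup c ℓ₁ ℓ₂) where
  open OrderedAbelianGroup R

  InCs : ∀ {a ℓ} {X : Set a} → Rel X ℓ → X → X → X → Set ℓ
  InCs _≼_ x₁ x₂ x = (x ≼ x₁) × (x ≼ x₂)

  record MCSModel {a} (X : Set a) (ℓ : Level) : Set (a ⊔ suc ℓ ⊔ c ⊔ ℓ₁ ⊔ ℓ₂) where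
    field
      _≼_       : Rel X ℓ
      isPartial : IsPartialOrder _≡_ _≼_
      s         : X → Carrier
      s-nonneg  : ∀ x → 0# ≤ s x
      S1        : ∀ {x₁ x₂} → x₁ ≼ x₂ → s x₁ ≤ s x₂
      S2        : ∀ {x₁ x₂} → x₁ ≼ x₂ → s x₁ ≈ s x₂ → x₁ ≡ x₂
      A1        : ∀ x₁ x₂ → Σ X λ m → InCs _≼_ x₁ x₂ m
                    × (∀ y → InCs _≼_ x₁ x₂ y → s y ≤ s m)
      A2        : ∀ x₁ x₂ x → x₁ ≼ x → x₂ ≼ x →
                    Σ X λ x₁₂ → InCs _≼_ x₁ x₂ x₁₂
                    × (s x₁ + s x₂ - s x₁₂ ≤ s x)

    s' : X → X → Carrier
    s' x₁ x₂ = s (proj₁ (A1 x₁ x₂))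

-- Take maximum common subelements m₁₂ of x₁, x₂ and m₂₃ of x₂, x₃.  Both lie
-- below x₂, so (A2) yields a common subelement z of m₁₂ and m₂₃ with
-- s m₁₂ + s m₂₃ - s z ≤ s x₂.  By transitivity z is also a common subelement
-- of x₁ and x₃, hence s z ≤ s'({x₁,x₃}), and the inequality follows.
module Submission where

open import Data.Product using (_,_; proj₁; proj₂)
open import Relation.Binary.Structures using (IsPartialOrder)
open import Algebra.Structures using (IsAbelianGroup)
open import Defs

module OrderedAbelianGroupProperties {c ℓ₁ ℓ₂} (R : OrderedAbelianGroup c ℓ₁ ℓ₂) where
  open OrderedAbelianGroup R
  open IsAbelianGroup isAbelianGroup using (assoc; comm; inverseˡ; identityʳ; ∙-congˡ)
    renaming (trans to ≈-trans)
  open IsPartialOrder isPartialOrder using (≤-respˡ-≈; ≤-respʳ-≈)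

  +-monoʳ-≤ : ∀ {x y} z → x ≤ y → z + x ≤ z + y
  +-monoʳ-≤ z x≤y = ≤-respʳ-≈ (comm _ z) (≤-respˡ-≈ (comm _ z) (+-monoˡ-≤ z x≤y))

  x-y+y≈x : ∀ x y → x - y + y ≈ x
  x-y+y≈x x y = ≈-trans (assoc x (- y) y) (≈-trans (∙-congˡ (inverseˡ y)) (identityʳ x))

  x-y≤z⇒x≤z+y : ∀ {x y z} → x - y ≤ z → x ≤ z + y
  x-y≤z⇒x≤z+y {x} {y} x-y≤z = ≤-respˡ-≈ (x-y+y≈x x y) (+-monoˡ-≤ y x-y≤z)

module MCSModelProperties {c ℓ₁ ℓ₂ a ℓ} {R : OrderedAbelianGroup c ℓ₁ ℓ₂} {X : Set a}
                          (M : MCSModel R X ℓ) where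
  open OrderedAbelianGroup R using (_≤_; _+_; isPartialOrder)
  open OrderedAbelianGroupProperties R using (+-monoʳ-≤; x-y≤z⇒x≤z+y)
  open IsPartialOrder isPartialOrder using () renaming (trans to ≤-trans)
  open MCSModel M
  open IsPartialOrder isPartial using () renaming (trans to ≼-trans)

  mcs : X → X → X
  mcs x₁ x₂ = proj₁ (A1 x₁ x₂)

  mcs-InCs : ∀ x₁ x₂ → InCs R _≼_ x₁ x₂ (mcs x₁ x₂)
  mcs-InCs x₁ x₂ = proj₁ (proj₂ (A1 x₁ x₂))

  s≤s' : ∀ {x₁ x₂ y} → InCs R _≼_ x₁ x₂ y → s y ≤ s' x₁ x₂
  s≤s' {x₁} {x₂} {y} = proj₂ (proj₂ (A1 x₁ x₂)) y

  InCs-trans : ∀ {x₁ x₂ y₁ y₂ z} → y₁ ≼ x₁ → y₂ ≼ x₂ →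
               InCs R _≼_ y₁ y₂ z → InCs R _≼_ x₁ x₂ z
  InCs-trans y₁≼x₁ y₂≼x₂ (z≼y₁ , z≼y₂) = ≼-trans z≼y₁ y₁≼x₁ , ≼-trans z≼y₂ y₂≼x₂

  s'-through-middle : ∀ x₁ x₂ x₃ → s' x₁ x₂ + s' x₂ x₃ ≤ s x₂ + s' x₁ x₃
  s'-through-middle x₁ x₂ x₃
    with m₁₂≼x₁ , m₁₂≼x₂ ← mcs-InCs x₁ x₂
       | m₂₃≼x₂ , m₂₃≼x₃ ← mcs-InCs x₂ x₃
    with _ , z∈cs , bound ← A2 (mcs x₁ x₂) (mcs x₂ x₃) x₂ m₁₂≼x₂ m₂₃≼x₂
    = ≤-trans (x-y≤z⇒x≤z+y bound)
              (+-monoʳ-≤ (s x₂) (s≤s' (InCs-trans m₁₂≼x₁ m₂₃≼x₃ z∈cs)))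

lemma2 : ∀ {c ℓ₁ ℓ₂ a ℓ} (R : OrderedAbelianGroup c ℓ₁ ℓ₂) {X : Set a}
         (M : MCSModel R X ℓ) (x₁ x₂ x₃ : X) →
         OrderedAbelianGroup._≤_ R
           (OrderedAbelianGroup._+_ R (MCSModel.s' M x₁ x₂) (MCSModel.s' M x₂ x₃))
           (OrderedAbelianGroup._+_ R (MCSModel.s M x₂) (MCSModel.s' M x₁ x₃))
lemma2 R M = MCSModelProperties.s'-through-middle M
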